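{- Let $G$ be a graph on $n$ vertices $v_1,\dots,v_n$ with $m=e(G)$ edges, let $k$ be an integer with $0\leq k<n-2$, and write $G_i=G-v_i$. Define $$\widetilde{m}=\left\lfloor\frac1{n-2-k}\sum_{i=1}^{n-k}e(G_i)\right\rfloor.$$ Then $\widetilde{m}=m+\alpha$ for some integer $\alpha$ with $0\leq\alpha\leq\left\lfloor\frac{k(n-1)}{n-2-k}\right\rfloor$.
   Context: All graphs are finite, simple and undirected; $e(\cdot)$ denotes the number of edges. $G-v$ is the graph obtained from $G$ by deleting the vertex $v$ and all edges incident to it. -}

module Defs where

open import Data.Nat using (ℕ; zero; suc; _+_; _*_; _∸_; _<_; _<ᵇ_; NonZero; >-nonZero)
open import Data.Nat.Properties using (m<n⇒0<n∸m; ∸-+-assoc)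
open import Data.Nat.DivMod using (_/_)
open import Data.Bool using (Bool; true; false; _∧_; if_then_else_)
open import Data.Fin using (Fin; toℕ; punchIn)
open import Data.List using (List; map; take; allFin)
open import Data.Nat.ListAction using (sum)
open import Relation.Binary.PropositionalEquality using (_≡_; subst; sym)

record Graph (n : ℕ) : Set where
  field
    adj     : Fin n → Fin n → Bool
    symm    : ∀ i j → adj i j ≡ adj j i
    irrefl  : ∀ i → adj i i ≡ false
open Graph public

e : ∀ {n} → Graph n → ℕ
e {n} G = sum (map (λ i → sum (map (λ j →
            if (toℕ i <ᵇ toℕ j) ∧ adj G i j then 1 else 0) (allFin n))) (allFin n))

-- G - v : delete vertex v (remaining vertices relabelled order-preservingly).
_-_ : ∀ {n} → Graph (suc n) → Fin (suc n) → Graph n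
G - v = record
  { adj    = λ a b → adj G (punchIn v a) (punchIn v b)
  ; symm   = λ a b → symm G (punchIn v a) (punchIn v b)
  ; irrefl = λ a → irrefl G (punchIn v a)
  }

-- e(G - v_i), for a vertex of a graph with n vertices (n ≥ 1 automatically since Fin n is inhabited).
eDel : ∀ {n} → Graph n → Fin n → ℕ
eDel {suc n} G i = e (G - i)

sumDel : ∀ {n} → Graph n → ℕ → ℕ
sumDel {n} G k = sum (map (eDel G) (take (n ∸ k) (allFin n)))

denNonZero : ∀ n k → 2 + k < n → NonZero (n ∸ 2 ∸ k)
denNonZero n k h = >-nonZero (subst (0 <_) (sym (∸-+-assoc n 2 k)) (m<n⇒0<n∸m h))
  where open import Data.Nat using (_<_)

mTilde : ∀ {n} (G : Graph n) (k : ℕ) → 2 + k < n → ℕ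
mTilde {n} G k h = _/_ (sumDel G k) (n ∸ 2 ∸ k) {{denNonZero n k h}}

alphaBound : (n k : ℕ) → 2 + k < n → ℕ
alphaBound n k h = _/_ (k * (n ∸ 1)) (n ∸ 2 ∸ k) {{denNonZero n k h}}

-- Deleting v removes exactly its deg(v) edges, so Σ_{i ≤ n-k} e(G_i) equals
-- (n-k)·m − Σ_{i ≤ n-k} deg(v_i), and by the handshake lemma
-- Σ_{i ≤ n-k} deg(v_i) = 2m − Σ_{i > n-k} deg(v_i).  Hence
-- Σ_{i ≤ n-k} e(G_i) = (n-2-k)·m + D with D the degree sum of the last k
-- vertices, so m̃ = m + ⌊D/(n-2-k)⌋, and 0 ≤ D ≤ k(n-1) bounds α.
module Submission where

open import Defs
open import Data.Nat using (ℕ; zero; suc; _+_; _*_; _∸_; _⊓_; _<_; _≤_; _<ᵇ_; NonZero; z≤n)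
open import Data.Product using (∃-syntax; _×_; _,_)
open import Relation.Binary.PropositionalEquality using (_≡_; refl; sym; trans; cong; cong₂; subst; module ≡-Reasoning)

import Algebra.Properties.CommutativeMonoid.Sum as Fin∑
open import Data.Bool using (false; true; _∧_; if_then_else_)
open import Data.Bool.Properties using (T-≡; ¬-not)
open import Data.Fin using (Fin; toℕ; punchIn)
open import Data.Fin.Properties using (toℕ-injective)
open import Data.List using (List; []; _∷_; map; take; drop; allFin; length; tabulate; _++_)
open import Data.List.Properties using (map-tabulate; length-tabulate; length-take; length-drop; take++drop≡id; map-++)
open import Data.Nat.DivMod using (_/_; m*n/n≡m; /-monoˡ-≤; +-distrib-/-∣ˡ)
open import Data.Nat.Divisibility using (n∣m*n)
open import Data.Nat.ListAction using (sum)
open import Data.Nat.ListAction.Properties using (sum-++)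
open import Data.Nat.Properties
open import Data.Nat.Solver using (module +-*-Solver)
open import Function.Bundles using (Equivalence)
open import Relation.Binary using (tri<; tri≈; tri>)

open Fin∑ +-0-commutativeMonoid using (sum-syntax; sum-cong-≗; sum-remove; ∑-distrib-+; ∑-comm)
  renaming (sum to ∑)
open +-*-Solver using (solve; _:=_; _:+_; _:*_; con)

sum-map-allFin : ∀ n (f : Fin n → ℕ) → sum (map f (allFin n)) ≡ ∑ f
sum-map-allFin n f = trans (cong sum (map-tabulate (λ i → i) f)) (sum-tabulate n f)
  where
  sum-tabulate : ∀ n (f : Fin n → ℕ) → sum (tabulate f) ≡ ∑ f
  sum-tabulate zero    f = refl
  sum-tabulate (suc n) f = cong (f Fin.zero +_) (sum-tabulate n (λ i → f (Fin.suc i)))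

sum-map-≤-* : ∀ {A : Set} (f : A → ℕ) {c} (xs : List A) → (∀ x → f x ≤ c) →
              sum (map f xs) ≤ length xs * c
sum-map-≤-* f []       f≤c = z≤n
sum-map-≤-* f (x ∷ xs) f≤c = +-mono-≤ (f≤c x) (sum-map-≤-* f xs f≤c)

∑-≤-* : ∀ {n} (f : Fin n → ℕ) {c} → (∀ i → f i ≤ c) → ∑ f ≤ n * c
∑-≤-* {n} f {c} f≤c = begin
  ∑ f                          ≡⟨ sum-map-allFin n f ⟨
  sum (map f (allFin n))       ≤⟨ sum-map-≤-* f (allFin n) f≤c ⟩
  length (allFin n) * c        ≡⟨ cong (_* c) (length-tabulate {n = n} (λ i → i)) ⟩
  n * c                        ∎
  where open ≤-Reasoning

sum-map-take+drop : ∀ {A : Set} (f : A → ℕ) t (xs : List A) →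
                    sum (map f (take t xs)) + sum (map f (drop t xs)) ≡ sum (map f xs)
sum-map-take+drop f t xs = begin
  sum (map f (take t xs)) + sum (map f (drop t xs))  ≡⟨ sum-++ (map f (take t xs)) _ ⟨
  sum (map f (take t xs) ++ map f (drop t xs))       ≡⟨ cong sum (map-++ f (take t xs) _) ⟨
  sum (map f (take t xs ++ drop t xs))               ≡⟨ cong (λ ys → sum (map f ys)) (take++drop≡id t xs) ⟩
  sum (map f xs)                                     ∎
  where open ≡-Reasoning

sum-map-+-const : ∀ {A : Set} (f g : A → ℕ) {c} (xs : List A) → (∀ x → f x + g x ≡ c) →
                  sum (map f xs) + sum (map g xs) ≡ length xs * c
sum-map-+-const f g []       f+g≡c = refl
sum-map-+-const f g {c} (x ∷ xs) f+g≡c = begin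
  (f x + Σf) + (g x + Σg)  ≡⟨ solve 4 (λ a b p q → (a :+ b) :+ (p :+ q) := (a :+ p) :+ (b :+ q)) refl (f x) Σf (g x) Σg ⟩
  (f x + g x) + (Σf + Σg)  ≡⟨ cong₂ _+_ (f+g≡c x) (sum-map-+-const f g xs f+g≡c) ⟩
  c + length xs * c       ∎
  where
  open ≡-Reasoning
  Σf = sum (map f xs)
  Σg = sum (map g xs)

∑-removeAt-zero : ∀ {n} (f : Fin (suc n) → ℕ) v → f v ≡ 0 → ∑ f ≡ ∑[ j < n ] f (punchIn v j)
∑-removeAt-zero {n} f v fv≡0 = trans (sum-remove {i = v} f) (cong (_+ ∑[ j < n ] f (punchIn v j)) fv≡0)

<ᵇ≡false : ∀ {m n} → n ≤ m → (m <ᵇ n) ≡ false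
<ᵇ≡false {m} {n} n≤m = ¬-not (λ m<ᵇn → ≤⇒≯ n≤m (<ᵇ⇒< m n (Equivalence.from T-≡ m<ᵇn)))

module _ {n : ℕ} (G : Graph n) where

  edge : Fin n → Fin n → ℕ
  edge i j = if adj G i j then 1 else 0

  forwardEdge : Fin n → Fin n → ℕ
  forwardEdge i j = if (toℕ i <ᵇ toℕ j) ∧ adj G i j then 1 else 0

  degree : Fin n → ℕ
  degree v = ∑[ j < n ] edge v j

  e≡∑∑forwardEdge : e G ≡ ∑[ i < n ] ∑[ j < n ] forwardEdge i j
  e≡∑∑forwardEdge = trans (sum-map-allFin n (λ i → sum (map (forwardEdge i) (allFin n))))
                          (sum-cong-≗ (λ i → sum-map-allFin n (forwardEdge i)))

  edge≤1 : ∀ i j → edge i j ≤ 1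
  edge≤1 i j with adj G i j
  ... | true  = ≤-refl
  ... | false = z≤n

  edge-refl : ∀ v → edge v v ≡ 0
  edge-refl v rewrite irrefl G v = refl

  edge-sym : ∀ i j → edge i j ≡ edge j i
  edge-sym i j = cong (λ b → if b then 1 else 0) (symm G i j)

  forwardEdge-< : ∀ {i j} → toℕ i < toℕ j → forwardEdge i j ≡ edge i j
  forwardEdge-< i<j rewrite Equivalence.to T-≡ (<⇒<ᵇ i<j) = refl

  forwardEdge-≥ : ∀ {i j} → toℕ j ≤ toℕ i → forwardEdge i j ≡ 0
  forwardEdge-≥ j≤i rewrite <ᵇ≡false j≤i = refl

  edge≡forwardEdge+forwardEdge : ∀ i j → edge i j ≡ forwardEdge i j + forwardEdge j i
  edge≡forwardEdge+forwardEdge i j with <-cmp (toℕ i) (toℕ j)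
  ... | tri< i<j _ _ rewrite forwardEdge-< i<j | forwardEdge-≥ (<⇒≤ i<j) = sym (+-identityʳ _)
  ... | tri> _ _ j<i rewrite forwardEdge-< j<i | forwardEdge-≥ (<⇒≤ j<i) = edge-sym i j
  ... | tri≈ _ i≡j _ with refl ← toℕ-injective i≡j
    rewrite edge-refl i | forwardEdge-≥ {i} {i} ≤-refl = refl

  degree≡out+in : ∀ v → degree v ≡ ∑[ j < n ] forwardEdge v j + ∑[ j < n ] forwardEdge j v
  degree≡out+in v = trans (sum-cong-≗ (edge≡forwardEdge+forwardEdge v)) (∑-distrib-+ (forwardEdge v) (λ j → forwardEdge j v))

  handshake : ∑ degree ≡ e G + e G
  handshake = begin
    ∑[ v < n ] degree v
      ≡⟨ trans (sum-cong-≗ degree≡out+in)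
               (∑-distrib-+ (λ v → ∑[ j < n ] forwardEdge v j) (λ v → ∑[ j < n ] forwardEdge j v)) ⟩
    ∑[ v < n ] ∑[ j < n ] forwardEdge v j + ∑[ v < n ] ∑[ j < n ] forwardEdge j v
      ≡⟨ cong (∑[ v < n ] ∑[ j < n ] forwardEdge v j +_) (∑-comm (λ v j → forwardEdge j v)) ⟩
    ∑[ v < n ] ∑[ j < n ] forwardEdge v j + ∑[ j < n ] ∑[ v < n ] forwardEdge j v
      ≡⟨ cong₂ _+_ e≡∑∑forwardEdge e≡∑∑forwardEdge ⟨
    e G + e G
      ∎
    where open ≡-Reasoning

punchIn-<ᵇ : ∀ {n} (v : Fin (suc n)) (i j : Fin n) →
             (toℕ (punchIn v i) <ᵇ toℕ (punchIn v j)) ≡ (toℕ i <ᵇ toℕ j)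
punchIn-<ᵇ Fin.zero    i           j           = refl
punchIn-<ᵇ (Fin.suc v) Fin.zero    Fin.zero    = refl
punchIn-<ᵇ (Fin.suc v) Fin.zero    (Fin.suc j) = refl
punchIn-<ᵇ (Fin.suc v) (Fin.suc i) Fin.zero    = refl
punchIn-<ᵇ (Fin.suc v) (Fin.suc i) (Fin.suc j) = punchIn-<ᵇ v i j

module _ {n : ℕ} (G : Graph (suc n)) where

  forwardEdge-punchIn : ∀ v i j → forwardEdge G (punchIn v i) (punchIn v j) ≡ forwardEdge (G - v) i j
  forwardEdge-punchIn v i j rewrite punchIn-<ᵇ v i j = refl

  e≡degree+e-delete : ∀ v → e G ≡ degree G v + e (G - v)
  e≡degree+e-delete v = begin
    e G
      ≡⟨ e≡∑∑forwardEdge G ⟩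
    ∑[ i < suc n ] ∑[ j < suc n ] F i j
      ≡⟨ sum-remove {i = v} (λ i → ∑[ j < suc n ] F i j) ⟩
    ∑[ j < suc n ] F v j + ∑[ i < n ] ∑[ j < suc n ] F (p i) j
      ≡⟨ cong₂ _+_ (∑-removeAt-zero (F v) v (forwardEdge-refl v))
                   (sum-cong-≗ (λ i → sum-remove {i = v} (F (p i)))) ⟩
    out + ∑[ i < n ] (F (p i) v + ∑[ j < n ] F (p i) (p j))
      ≡⟨ cong (out +_) (∑-distrib-+ (λ i → F (p i) v) (λ i → ∑[ j < n ] F (p i) (p j))) ⟩
    out + (inn + ∑[ i < n ] ∑[ j < n ] F (p i) (p j))
      ≡⟨ cong (λ x → out + (inn + x)) (trans (sum-cong-≗ (λ i → sum-cong-≗ (forwardEdge-punchIn v i)))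
                                             (sym (e≡∑∑forwardEdge (G - v)))) ⟩
    out + (inn + e (G - v))
      ≡⟨ +-assoc out inn _ ⟨
    out + inn + e (G - v)
      ≡⟨ cong (_+ e (G - v)) degree≡out+inn ⟨
    degree G v + e (G - v)
      ∎
    where
    open ≡-Reasoning
    F = forwardEdge G
    p = punchIn v
    out = ∑[ j < n ] F v (p j)
    inn = ∑[ j < n ] F (p j) v
    forwardEdge-refl : ∀ v → F v v ≡ 0
    forwardEdge-refl v = forwardEdge-≥ G {v} {v} ≤-refl
    degree≡out+inn : degree G v ≡ out + inn
    degree≡out+inn = trans (degree≡out+in G v)
      (cong₂ _+_ (∑-removeAt-zero (F v) v (forwardEdge-refl v))
                 (∑-removeAt-zero (λ j → F j v) v (forwardEdge-refl v)))

  degree≤ : ∀ v → degree G v ≤ n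
  degree≤ v = begin
    degree G v                         ≡⟨ ∑-removeAt-zero (edge G v) v (edge-refl G v) ⟩
    ∑[ j < n ] edge G v (punchIn v j)  ≤⟨ ∑-≤-* _ (λ j → edge≤1 G v (punchIn v j)) ⟩
    n * 1                              ≡⟨ *-identityʳ n ⟩
    n                                  ∎
    where open ≤-Reasoning

  vertices : List (Fin (suc n))
  vertices = allFin (suc n)

  sum-eDel-take : ∀ t → t ≤ suc n →
    sum (map (eDel G) (take t vertices)) + (e G + e G) ≡ t * e G + sum (map (degree G) (drop t vertices))
  sum-eDel-take t t≤n+1 = begin
    S + (e G + e G)   ≡⟨ cong (S +_) degree-sum ⟨
    S + (D₁ + D₂)     ≡⟨ +-assoc S D₁ D₂ ⟨
    (S + D₁) + D₂     ≡⟨ cong (_+ D₂) (sum-map-+-const (eDel G) (degree G) (take t vertices) eDel+degree≡e) ⟩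
    length (take t vertices) * e G + D₂
                      ≡⟨ cong (λ x → x * e G + D₂) length-take-vertices ⟩
    t * e G + D₂      ∎
    where
    open ≡-Reasoning
    S = sum (map (eDel G) (take t vertices))
    D₁ = sum (map (degree G) (take t vertices))
    D₂ = sum (map (degree G) (drop t vertices))
    degree-sum : D₁ + D₂ ≡ e G + e G
    degree-sum = trans (sum-map-take+drop (degree G) t vertices)
                       (trans (sum-map-allFin (suc n) (degree G)) (handshake G))
    eDel+degree≡e : ∀ v → eDel G v + degree G v ≡ e G
    eDel+degree≡e v = trans (+-comm (eDel G v) _) (sym (e≡degree+e-delete v))
    length-take-vertices : length (take t vertices) ≡ t
    length-take-vertices = trans (length-take t vertices)
      (trans (cong (t ⊓_) (length-tabulate (λ i → i))) (m≤n⇒m⊓n≡m t≤n+1))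

  sum-degree-drop≤ : ∀ t → sum (map (degree G) (drop t vertices)) ≤ (suc n ∸ t) * n
  sum-degree-drop≤ t = subst (λ l → sum (map (degree G) (drop t vertices)) ≤ l * n) length-drop-vertices
                             (sum-map-≤-* (degree G) (drop t vertices) degree≤)
    where
    length-drop-vertices : length (drop t vertices) ≡ suc n ∸ t
    length-drop-vertices = trans (length-drop t vertices) (cong (_∸ t) (length-tabulate {n = suc n} (λ i → i)))

m∸o≡m∸n∸o+n : ∀ {m} n o → n + o ≤ m → m ∸ o ≡ m ∸ n ∸ o + n
m∸o≡m∸n∸o+n {m} n o n+o≤m = sym (begin
  m ∸ n ∸ o + n    ≡⟨ cong (_+ n) (∸-+-assoc m n o) ⟩
  m ∸ (n + o) + n  ≡⟨ cong (λ x → m ∸ x + n) (+-comm n o) ⟩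
  m ∸ (o + n) + n  ≡⟨ cong (_+ n) (∸-+-assoc m o n) ⟨
  m ∸ o ∸ n + n    ≡⟨ m∸n+n≡m (m+n≤o⇒m≤o∸n n n+o≤m) ⟩
  m ∸ o            ∎)
  where open ≡-Reasoning

[m*n+o]/n≡m+o/n : ∀ m n o .{{_ : NonZero n}} → (m * n + o) / n ≡ m + o / n
[m*n+o]/n≡m+o/n m n o = trans (+-distrib-/-∣ˡ o (n∣m*n m)) (cong (_+ o / n) (m*n/n≡m m n))

lemma3 : (n k : ℕ) (G : Graph n) (h : 2 + k < n) →
         ∃[ α ] (mTilde G k h ≡ e G + α × α ≤ alphaBound n k h)
lemma3 (suc n) k G h = D / d , mTilde≡e+D/d , /-monoˡ-≤ d D≤k*n
  where
  instance
    d≢0 : NonZero (suc n ∸ 2 ∸ k)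
    d≢0 = denNonZero (suc n) k h
  d t D : ℕ
  d = suc n ∸ 2 ∸ k
  t = suc n ∸ k
  D = sum (map (degree G) (drop t (vertices G)))

  sumDel≡e*d+D : sumDel G k ≡ e G * d + D
  sumDel≡e*d+D = +-cancelʳ-≡ (e G + e G) _ _ (begin
    sumDel G k + (e G + e G)   ≡⟨ sum-eDel-take G t (m∸n≤m (suc n) k) ⟩
    t * e G + D                ≡⟨ cong (λ x → x * e G + D) (m∸o≡m∸n∸o+n 2 k (<⇒≤ h)) ⟩
    (d + 2) * e G + D          ≡⟨ solve 3 (λ x m y → (x :+ con 2) :* m :+ y := (m :* x :+ y) :+ (m :+ m)) refl d (e G) D ⟩
    e G * d + D + (e G + e G)  ∎)
    where open ≡-Reasoning

  mTilde≡e+D/d : mTilde G k h ≡ e G + D / d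
  mTilde≡e+D/d = trans (cong (_/ d) sumDel≡e*d+D) ([m*n+o]/n≡m+o/n (e G) d D)

  D≤k*n : D ≤ k * n
  D≤k*n = subst (λ x → D ≤ x * n) (m∸[m∸n]≡n (≤-trans (m≤n+m k 2) (<⇒≤ h))) (sum-degree-drop≤ G t)
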